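{- Let $G$ be a graph with $n$ vertices, $k$ a positive integer, and let the strings family $\mathcal{C}$, length $L$ and bound $d$ be constructed from $(G,k)$, $\ell$, $\mathcal{S}$ and $\iota$ as described in the context. If there is a string $w\in\{0,1\}^L$ such that $\mathrm{Ham}(w,x)<d+\ell/20$ for each $x\in\mathcal{C}$, then $G$ contains a clique on $k$ vertices.
   Context: $\mathrm{Ham}(x,y)$ is the Hamming distance of equal-length strings, $\mathrm{Hw}(x)$ the number of $1$s in a binary string, and $\overline{x}$ the complement of a binary string $x$ (all $0$s and $1$s swapped). Let $\ell$ be a positive integer divisible by $100$, and $\mathcal{S}\subseteq\{0,1\}^\ell$ a set with $|\mathcal{S}|=n$ such that $\mathrm{Hw}(x)=\ell/2$ for all $x\in\mathcal{S}$ and $(1/2-1/100)\ell<\mathrm{Ham}(x,y)<(1/2+1/100)\ell$ for all distinct $x,y\in\mathcal{S}$. Let $\mathcal{F}=\{y\in\{0,1\}^\ell:\mathrm{Ham}(x,y)\le(9/10)\ell\ \forall x\in\mathcal{S}\}$, and let $\iota:V(G)\to\mathcal{S}$ be a bijection. Set $\gamma=11/100$ and $L=k\ell+\gamma\ell$; positions $\{1,\dots,L\}$ are split into blocks $B_i=\{(i-1)\ell+1,\dots,i\ell\}$ for $i\in[k]$ and $C=\{k\ell+1,\dots,L\}$. For a string $w$ and a block $X$, $w[X]$ is the substring on $X$. The family $\mathcal{C}=\mathcal{C}_{sel}\cup\mathcal{C}_{adj}$ where: $\mathcal{C}_{sel}$ consists of strings $a(i,y,\phi,z)$ for all $i\in[k]$,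 $y\in\mathcal{F}$, $\phi:[k]\setminus\{i\}\to\{0,1\}$, $z\in\{0,1\}^{\gamma\ell}$, with $y$ on $B_i$, on each $B_j$ ($j\ne i$) the all-$0$ string if $\phi(j)=0$ and the all-$1$ string if $\phi(j)=1$, and $z$ on $C$; $\mathcal{C}_{adj}$ consists of strings $b(i,j,(u,v),\psi)$ for all $i<j$ in $[k]$, all ordered pairs $(u,v)$ of vertices of $G$ that are equal or non-adjacent, and $\psi:[k]\setminus\{i,j\}\to\{0,1\}$, with $\overline{\iota(u)}$ on $B_i$, $\overline{\iota(v)}$ on $B_j$, on each $B_q$ ($q\ne i,j$) the all-$0$ string if $\psi(q)=0$ and all-$1$ string if $\psi(q)=1$, and all zeroes on $C$. Finally $d=(k/2+1/2+1/100)\ell$. -}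

module Defs where

open import Data.Bool using (Bool; true; false; not; if_then_else_)
open import Data.Nat using (ℕ; zero; suc; _+_; _*_; _<_; _≤_; _/_)
open import Data.Fin using (Fin; _≟_)
open import Data.Vec using (Vec; []; _∷_; map; replicate; concat; _++_; tabulate)
open import Data.Product using (Σ; _×_; _,_; ∃)
open import Data.Sum using (_⊎_)
open import Relation.Nullary using (¬_; Dec; yes; no)
open import Relation.Binary using (Decidable)
open import Relation.Binary.PropositionalEquality using (_≡_; _≢_)
open import Function.Definitions using (Injective)

record SimpleGraph (n : ℕ) : Set₁ where
  field
    Adj    : Fin n → Fin n → Set
    adj?   : Decidable Adj
    sym    : ∀ {u v} → Adj u v → Adj v u
    irrefl : ∀ {u} → ¬ Adj u u
open SimpleGraph public

HasClique : ∀ {n} → SimpleGraph n → ℕ → Set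
HasClique {n} G k =
  Σ (Fin k → Fin n) λ f → Injective _≡_ _≡_ f × (∀ a b → a ≢ b → Adj G (f a) (f b))

Ham : ∀ {m} → Vec Bool m → Vec Bool m → ℕ
Ham [] [] = 0
Ham (true  ∷ xs) (false ∷ ys) = suc (Ham xs ys)
Ham (false ∷ xs) (true  ∷ ys) = suc (Ham xs ys)
Ham (true  ∷ xs) (true  ∷ ys) = Ham xs ys
Ham (false ∷ xs) (false ∷ ys) = Ham xs ys

Hw : ∀ {m} → Vec Bool m → ℕ
Hw [] = 0
Hw (true  ∷ xs) = suc (Hw xs)
Hw (false ∷ xs) = Hw xs

compl : ∀ {m} → Vec Bool m → Vec Bool m
compl = map not

-- γℓ = (11/100) ℓ  (exact when 100 ∣ ℓ)
γℓ : ℕ → ℕ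
γℓ ℓ = 11 * (ℓ / 100)

-- L = kℓ + γℓ ; strings of length L are the concatenation of k blocks of length ℓ
-- (B_1,...,B_k, in order) followed by the block C of length γℓ.
Len : ℕ → ℕ → ℕ
Len k ℓ = k * ℓ + γℓ ℓ

assemble : ∀ {k ℓ} → (Fin k → Vec Bool ℓ) → Vec Bool (γℓ ℓ) → Vec Bool (Len k ℓ)
assemble blocks c = concat (tabulate blocks) ++ c

const : ∀ {ℓ} → Bool → Vec Bool ℓ
const b = replicate _ b

-- The family 𝓕 : strings y with Ham(ι x, y) ≤ (9/10)ℓ for all x ∈ 𝓢 = image of ι.
InF : ∀ {n ℓ} → (Fin n → Vec Bool ℓ) → Vec Bool ℓ → Set
InF {n} {ℓ} ι y = ∀ (u : Fin n) → 10 * Ham (ι u) y ≤ 9 * ℓ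

-- a(i, y, φ, z).  φ is given as a function on all of [k]; its value at i is ignored.
aStr : ∀ {k ℓ} → Fin k → Vec Bool ℓ → (Fin k → Bool) → Vec Bool (γℓ ℓ) → Vec Bool (Len k ℓ)
aStr i y φ z = assemble (λ j → blk j (j ≟ i)) z
  where
  blk : ∀ j → Dec (j ≡ i) → Vec Bool _
  blk j (yes _) = y
  blk j (no  _) = const (φ j)

-- b(i, j, (u,v), ψ).  ψ is given on all of [k]; its values at i, j are ignored.
bStr : ∀ {n k ℓ} → (Fin n → Vec Bool ℓ) → Fin k → Fin k → Fin n → Fin n →
       (Fin k → Bool) → Vec Bool (Len k ℓ)
bStr {n} {k} {ℓ} ι i j u v ψ = assemble (λ q → blk q (q ≟ i) (q ≟ j)) (const false)
  where
  blk : ∀ q → Dec (q ≡ i) → Dec (q ≡ j) → Vec Bool ℓ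
  blk q (yes _) _       = compl (ι u)
  blk q (no _)  (yes _) = compl (ι v)
  blk q (no _)  (no _)  = const (ψ q)

-- Hypotheses on ℓ, 𝓢 and ι : V(G) → 𝓢 (bijection onto 𝓢 = image of an injective ι).
-- Rational conditions are multiplied out by 100.
GoodCode : ∀ {n} → (ℓ : ℕ) → (Fin n → Vec Bool ℓ) → Set
GoodCode {n} ℓ ι =
    Injective _≡_ _≡_ ι
  × (∀ u → 2 * Hw (ι u) ≡ ℓ)
  × (∀ u v → u ≢ v → 49 * ℓ < 100 * Ham (ι u) (ι v) × 100 * Ham (ι u) (ι v) < 51 * ℓ)

-- "Ham(w,x) < d + ℓ/20 for every x ∈ 𝓒", with d + ℓ/20 = (k/2 + 1/2 + 1/100 + 1/20) ℓ,
-- i.e. 100·Ham(w,x) < (50k + 56) ℓ.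
Close : ∀ {k ℓ} → Vec Bool (Len k ℓ) → Vec Bool (Len k ℓ) → Set
Close {k} {ℓ} w x = 100 * Ham w x < (50 * k + 56) * ℓ

AllClose : ∀ {n ℓ} (k : ℕ) → SimpleGraph n → (Fin n → Vec Bool ℓ) → Vec Bool (Len k ℓ) → Set
AllClose {n} {ℓ} k G ι w =
    (∀ (i : Fin k) (y : Vec Bool ℓ) (φ : Fin k → Bool) (z : Vec Bool (γℓ ℓ)) →
       InF ι y → Close {k} {ℓ} w (aStr i y φ z))
  × (∀ (i j : Fin k) (u v : Fin n) (ψ : Fin k → Bool) →
       Data.Fin._<_ i j → (u ≡ v ⊎ ¬ Adj G u v) → Close {k} {ℓ} w (bStr ι i j u v ψ))

module Submission where

-- Cut the centre w into its blocks w₁ … w_k (one per B_i) and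
-- its C-part w_C.  For every block choose the constant string (all-0 or all-1) that
-- disagrees with w_j in at least half of the positions.
--
--  * For each i, the string a(i, w̄ᵢ, φ, w̄_C) with these constants is at distance
--    ≥ ℓ + (k-1)ℓ/2 + γℓ = (k/2 + 1/2 + 11/100)ℓ from w, which is too far; hence
--    w̄ᵢ ∉ 𝓕, i.e. some vertex uᵢ has Ham(ι uᵢ, w̄ᵢ) > 9ℓ/10.
--  * For i < j, if uᵢ = uⱼ or uᵢ, uⱼ are non-adjacent, the string b(i, j, (uᵢ,uⱼ), φ)
--    is at distance > 2·(9/10)ℓ + (k-2)ℓ/2 = (k/2 + 8/10)ℓ from w, again too far.
--    So i ↦ uᵢ is injective with pairwise adjacent values: a k-clique.

open import Defs hiding (sym)
open import Data.Bool using (Bool; true; false)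
open import Data.Nat using (ℕ; zero; suc; _+_; _*_; _/_; _≤_; _<_; _≤?_; z≤n)
open import Data.Nat.Properties
open import Data.Nat.DivMod using (m*n/n≡m)
open import Data.Nat.Divisibility using (_∣_; divides)
open import Data.Nat.Tactic.RingSolver using (solve-∀)
open import Algebra.Properties.Semiring.Sum +-*-semiring using (sum; *-distribˡ-sum)
open import Data.Vec using (Vec; []; _∷_; _++_; concat; tabulate; lookup; splitAt; group)
open import Data.Vec.Properties using (tabulate∘lookup)
open import Data.Fin using (Fin; zero; suc) renaming (_≟_ to _≟ᶠ_; _<_ to _<ᶠ_)
open import Data.Fin.Properties using (¬∀⟶∃¬) renaming (<-cmp to <ᶠ-cmp; <⇒≢ to <ᶠ⇒≢)
open import Data.Product using (Σ; ∃; ∃₂; _,_; proj₁; proj₂)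
open import Data.Sum using (_⊎_; inj₁; inj₂)
open import Data.Empty using (⊥-elim)
open import Relation.Binary using (Tri; tri<; tri≈; tri>)
open import Relation.Binary.PropositionalEquality
open import Relation.Nullary using (¬_; Dec; yes; no)
open import Function using (_∘_)

Ham-++ : ∀ {a b} (x x' : Vec Bool a) (y y' : Vec Bool b) →
         Ham (x ++ y) (x' ++ y') ≡ Ham x x' + Ham y y'
Ham-++ []          []           y y' = refl
Ham-++ (true ∷ x)  (true ∷ x')  y y' = Ham-++ x x' y y'
Ham-++ (true ∷ x)  (false ∷ x') y y' = cong suc (Ham-++ x x' y y')
Ham-++ (false ∷ x) (true ∷ x')  y y' = cong suc (Ham-++ x x' y y')
Ham-++ (false ∷ x) (false ∷ x') y y' = Ham-++ x x' y y'

Ham-assemble : ∀ {k ℓ} (xs ys : Fin k → Vec Bool ℓ) (c c' : Vec Bool (γℓ ℓ)) →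
               Ham (assemble xs c) (assemble ys c') ≡ sum (λ j → Ham (xs j) (ys j)) + Ham c c'
Ham-assemble xs ys c c' =
  trans (Ham-++ (concat (tabulate xs)) (concat (tabulate ys)) c c')
        (cong (_+ Ham c c') (Ham-concat xs ys))
  where
  Ham-concat : ∀ {k ℓ} (xs ys : Fin k → Vec Bool ℓ) →
               Ham (concat (tabulate xs)) (concat (tabulate ys)) ≡ sum (λ j → Ham (xs j) (ys j))
  Ham-concat {zero}  xs ys = refl
  Ham-concat {suc k} xs ys =
    trans (Ham-++ (xs zero) (ys zero) _ _)
          (cong (Ham (xs zero) (ys zero) +_) (Ham-concat (xs ∘ suc) (ys ∘ suc)))

Ham-compl-self : ∀ {m} (x : Vec Bool m) → Ham x (compl x) ≡ m
Ham-compl-self []          = refl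
Ham-compl-self (true ∷ x)  = cong suc (Ham-compl-self x)
Ham-compl-self (false ∷ x) = cong suc (Ham-compl-self x)

-- Complementing one argument may be moved to the other (both equal m - Ham x y).
Ham-compl-swap : ∀ {m} (x y : Vec Bool m) → Ham x (compl y) ≡ Ham y (compl x)
Ham-compl-swap []          []          = refl
Ham-compl-swap (true ∷ x)  (true ∷ y)  = cong suc (Ham-compl-swap x y)
Ham-compl-swap (true ∷ x)  (false ∷ y) = Ham-compl-swap x y
Ham-compl-swap (false ∷ x) (true ∷ y)  = Ham-compl-swap x y
Ham-compl-swap (false ∷ x) (false ∷ y) = cong suc (Ham-compl-swap x y)

Ham-const-true+false : ∀ {m} (x : Vec Bool m) → Ham x (const true) + Ham x (const false) ≡ m
Ham-const-true+false []          = refl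
Ham-const-true+false (true ∷ x)  = trans (+-suc _ _) (cong suc (Ham-const-true+false x))
Ham-const-true+false (false ∷ x) = cong suc (Ham-const-true+false x)

farBit : ∀ {m} → Vec Bool m → Bool
farBit {m} x with m ≤? 2 * Ham x (const true)
... | yes _ = true
... | no  _ = false

farBit-far : ∀ {m} (x : Vec Bool m) → m ≤ 2 * Ham x (const (farBit x))
farBit-far {m} x with m ≤? 2 * Ham x (const true)
... | yes m≤2t = m≤2t
... | no  m≰2t = ≮⇒≥ λ 2f<m → <-irrefl refl (begin-strict
    2 * m                              ≡⟨ cong (2 *_) (sym (Ham-const-true+false x)) ⟩
    2 * (t + f)                        ≡⟨ *-distribˡ-+ 2 t f ⟩
    2 * t + 2 * f                      <⟨ +-mono-< (≰⇒> m≰2t) 2f<m ⟩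
    m + m                              ≡⟨ cong (m +_) (sym (+-identityʳ m)) ⟩
    2 * m                              ∎)
  where
  open ≤-Reasoning
  t f : ℕ
  t = Ham x (const true)
  f = Ham x (const false)

sum-≥ : ∀ {k} a (g : Fin k → ℕ) → (∀ j → a ≤ g j) → k * a ≤ sum g
sum-≥ {zero}  a g ≥a = z≤n
sum-≥ {suc k} a g ≥a = +-mono-≤ (≥a zero) (sum-≥ a (g ∘ suc) (≥a ∘ suc))

sum-≥-one : ∀ {k} a e (g : Fin k → ℕ) i → (∀ j → a ≤ g j) → a + e ≤ g i → k * a + e ≤ sum g
sum-≥-one {suc k} a e g zero ≥a ≥a+e = begin
  (a + k * a) + e    ≡⟨ regroup a (k * a) e ⟩
  (a + e) + k * a    ≤⟨ +-mono-≤ ≥a+e (sum-≥ a (g ∘ suc) (≥a ∘ suc)) ⟩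
  sum g              ∎
  where open ≤-Reasoning
        regroup : ∀ x y z → (x + y) + z ≡ (x + z) + y
        regroup = solve-∀
sum-≥-one {suc k} a e g (suc i) ≥a ≥a+e = begin
  (a + k * a) + e    ≡⟨ +-assoc a (k * a) e ⟩
  a + (k * a + e)    ≤⟨ +-mono-≤ (≥a zero) (sum-≥-one a e (g ∘ suc) i (≥a ∘ suc) ≥a+e) ⟩
  sum g              ∎
  where open ≤-Reasoning

sum-≥-two : ∀ {k} a e e' (g : Fin k → ℕ) i j → i ≢ j → (∀ q → a ≤ g q) →
            a + e ≤ g i → a + e' ≤ g j → k * a + e + e' ≤ sum g
sum-≥-two a e e' g zero zero i≢j _ _ _ = ⊥-elim (i≢j refl)
sum-≥-two {suc k} a e e' g zero (suc j) _ ≥a ≥a+e ≥a+e' = begin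
  (a + k * a) + e + e'   ≡⟨ regroup a (k * a) e e' ⟩
  (a + e) + (k * a + e') ≤⟨ +-mono-≤ ≥a+e (sum-≥-one a e' (g ∘ suc) j (≥a ∘ suc) ≥a+e') ⟩
  sum g                  ∎
  where open ≤-Reasoning
        regroup : ∀ x y z z' → x + y + z + z' ≡ (x + z) + (y + z')
        regroup = solve-∀
sum-≥-two {suc k} a e e' g (suc i) zero _ ≥a ≥a+e ≥a+e' = begin
  (a + k * a) + e + e'   ≡⟨ regroup a (k * a) e e' ⟩
  (a + e') + (k * a + e) ≤⟨ +-mono-≤ ≥a+e' (sum-≥-one a e (g ∘ suc) i (≥a ∘ suc) ≥a+e) ⟩
  sum g                  ∎
  where open ≤-Reasoning
        regroup : ∀ x y z z' → x + y + z + z' ≡ (x + z') + (y + z)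
        regroup = solve-∀
sum-≥-two {suc k} a e e' g (suc i) (suc j) i≢j ≥a ≥a+e ≥a+e' = begin
  (a + k * a) + e + e'   ≡⟨ regroup a (k * a) e e' ⟩
  a + (k * a + e + e')   ≤⟨ +-mono-≤ (≥a zero) (sum-≥-two a e e' (g ∘ suc) i j (i≢j ∘ cong suc)
                                                          (≥a ∘ suc) ≥a+e ≥a+e') ⟩
  sum g                  ∎
  where open ≤-Reasoning
        regroup : ∀ x y z z' → x + y + z + z' ≡ x + (y + z + z')
        regroup = solve-∀

assemble-onto : ∀ {k ℓ} (w : Vec Bool (Len k ℓ)) → ∃₂ λ wb wc → w ≡ assemble {k} {ℓ} wb wc
assemble-onto {k} {ℓ} w with splitAt (k * ℓ) w
... | ws , wc , w≡ws++wc with group k ℓ ws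
... | wss , ws≡concat =
  lookup wss , wc ,
  trans w≡ws++wc (cong (_++ wc) (trans ws≡concat (cong concat (sym (tabulate∘lookup wss)))))

module _ {k ℓ} (i : Fin k) (y : Vec Bool ℓ) (φ : Fin k → Bool) (z : Vec Bool (γℓ ℓ)) where

  aStr-assembled : Σ (Fin k → Vec Bool ℓ) λ F → aStr i y φ z ≡ assemble F z
  aStr-assembled = _ , refl

  aBlock-sel : proj₁ aStr-assembled i ≡ y
  aBlock-sel with i ≟ᶠ i
  ... | yes _   = refl
  ... | no  i≢i = ⊥-elim (i≢i refl)

  aBlock-other : ∀ j → j ≢ i → proj₁ aStr-assembled j ≡ const (φ j)
  aBlock-other j j≢i with j ≟ᶠ i
  ... | yes j≡i = ⊥-elim (j≢i j≡i)
  ... | no  _   = refl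

module _ {n k ℓ} (ι : Fin n → Vec Bool ℓ) (i j : Fin k) (u v : Fin n) (ψ : Fin k → Bool) where

  bStr-assembled : Σ (Fin k → Vec Bool ℓ) λ F → bStr ι i j u v ψ ≡ assemble F (const false)
  bStr-assembled = _ , refl

  bBlock-fst : proj₁ bStr-assembled i ≡ compl (ι u)
  bBlock-fst with i ≟ᶠ i
  ... | yes _   = refl
  ... | no  i≢i = ⊥-elim (i≢i refl)

  bBlock-snd : i ≢ j → proj₁ bStr-assembled j ≡ compl (ι v)
  bBlock-snd i≢j with j ≟ᶠ i | j ≟ᶠ j
  ... | yes j≡i | _       = ⊥-elim (i≢j (sym j≡i))
  ... | no  _   | yes _   = refl
  ... | no  _   | no  j≢j = ⊥-elim (j≢j refl)

  bBlock-other : ∀ q → q ≢ i → q ≢ j → proj₁ bStr-assembled q ≡ const (ψ q)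
  bBlock-other q q≢i q≢j with q ≟ᶠ i | q ≟ᶠ j
  ... | yes q≡i | _       = ⊥-elim (q≢i q≡i)
  ... | no  _   | yes q≡j = ⊥-elim (q≢j q≡j)
  ... | no  _   | no  _   = refl

γℓ-exact : ∀ {ℓ} → 100 ∣ ℓ → 100 * γℓ ℓ ≡ 11 * ℓ
γℓ-exact (divides m refl) = begin
  100 * (11 * ((m * 100) / 100)) ≡⟨ cong (λ x → 100 * (11 * x)) (m*n/n≡m m 100) ⟩
  100 * (11 * m)                 ≡⟨ regroup m ⟩
  11 * (m * 100)                 ∎
  where open ≡-Reasoning
        regroup : ∀ m → 100 * (11 * m) ≡ 11 * (m * 100)
        regroup = solve-∀

a-string-far : ∀ k ℓ s c → k * (5 * ℓ) + 5 * ℓ ≤ 10 * s → 100 * c ≡ 11 * ℓ →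
               (50 * k + 56) * ℓ ≤ 100 * (s + c)
a-string-far k ℓ s c blocks≥ c≡ = begin
  (50 * k + 56) * ℓ                  ≤⟨ m≤m+n _ (5 * ℓ) ⟩
  (50 * k + 56) * ℓ + 5 * ℓ          ≡⟨ regroup k ℓ ⟩
  10 * (k * (5 * ℓ) + 5 * ℓ) + 11 * ℓ ≤⟨ +-mono-≤ (*-monoʳ-≤ 10 blocks≥) (≤-reflexive (sym c≡)) ⟩
  10 * (10 * s) + 100 * c            ≡⟨ regroup' s c ⟩
  100 * (s + c)                      ∎
  where open ≤-Reasoning
        regroup : ∀ k ℓ → (50 * k + 56) * ℓ + 5 * ℓ ≡ 10 * (k * (5 * ℓ) + 5 * ℓ) + 11 * ℓ
        regroup = solve-∀
        regroup' : ∀ s c → 10 * (10 * s) + 100 * c ≡ 100 * (s + c)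
        regroup' = solve-∀

b-string-far : ∀ k ℓ s c → k * (5 * ℓ) + 4 * ℓ + 4 * ℓ ≤ 10 * s →
               (50 * k + 56) * ℓ ≤ 100 * (s + c)
b-string-far k ℓ s c blocks≥ = begin
  (50 * k + 56) * ℓ                       ≤⟨ m≤m+n _ (24 * ℓ) ⟩
  (50 * k + 56) * ℓ + 24 * ℓ              ≡⟨ regroup k ℓ ⟩
  10 * (k * (5 * ℓ) + 4 * ℓ + 4 * ℓ)      ≤⟨ *-monoʳ-≤ 10 blocks≥ ⟩
  10 * (10 * s)                           ≡⟨ regroup' s ⟩
  100 * s                                 ≤⟨ *-monoʳ-≤ 100 (m≤m+n s c) ⟩
  100 * (s + c)                           ∎
  where open ≤-Reasoning
        regroup : ∀ k ℓ → (50 * k + 56) * ℓ + 24 * ℓ ≡ 10 * (k * (5 * ℓ) + 4 * ℓ + 4 * ℓ)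
        regroup = solve-∀
        regroup' : ∀ s → 10 * (10 * s) ≡ 100 * s
        regroup' = solve-∀

far-block : ∀ ℓ h → 9 * ℓ < 10 * h → 5 * ℓ + 4 * ℓ ≤ 10 * h
far-block ℓ h 9ℓ<10h = ≤-trans (≤-reflexive (sym (*-distribʳ-+ ℓ 5 4))) (<⇒≤ 9ℓ<10h)

-- The argument for a centre w with blocks wb and C-part wc that is close to every
-- string of 𝓒.  (Case analyses go through helper functions rather than 'with',
-- which would normalise the large types mentioning φ and f.)
module CliqueFromCentre {n} (G : SimpleGraph n) (k ℓ : ℕ) (ι : Fin n → Vec Bool ℓ)
  (γℓ≡ : 100 * γℓ ℓ ≡ 11 * ℓ)
  (wb : Fin k → Vec Bool ℓ) (wc : Vec Bool (γℓ ℓ)) (close : AllClose k G ι (assemble wb wc)) where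

  w : Vec Bool (Len k ℓ)
  w = assemble wb wc

  φ : Fin k → Bool
  φ j = farBit (wb j)

  φ-far : ∀ j → 5 * ℓ ≤ 10 * Ham (wb j) (const (φ j))
  φ-far j = ≤-trans (*-monoʳ-≤ 5 (farBit-far (wb j)))
                    (≤-reflexive (sym (*-assoc 5 2 (Ham (wb j) (const (φ j))))))

  aBlocks : Fin k → Fin k → Vec Bool ℓ
  aBlocks i = proj₁ (aStr-assembled i (compl (wb i)) φ (compl wc))

  aBlock-sel-far : ∀ i → 5 * ℓ + 5 * ℓ ≤ 10 * Ham (wb i) (aBlocks i i)
  aBlock-sel-far i rewrite aBlock-sel i (compl (wb i)) φ (compl wc) | Ham-compl-self (wb i) =
    ≤-reflexive (sym (*-distribʳ-+ ℓ 5 5))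

  aBlock-far : ∀ i j → 5 * ℓ ≤ 10 * Ham (wb j) (aBlocks i j)
  aBlock-far i j = by-cases (j ≟ᶠ i)
    where
    by-cases : Dec (j ≡ i) → 5 * ℓ ≤ 10 * Ham (wb j) (aBlocks i j)
    by-cases (yes refl) = ≤-trans (m≤m+n (5 * ℓ) (5 * ℓ)) (aBlock-sel-far i)
    by-cases (no j≢i)   = subst (λ x → 5 * ℓ ≤ 10 * Ham (wb j) x)
                                (sym (aBlock-other i (compl (wb i)) φ (compl wc) j j≢i)) (φ-far j)

  a-far : ∀ i → (50 * k + 56) * ℓ ≤ 100 * Ham w (aStr i (compl (wb i)) φ (compl wc))
  a-far i = begin
    (50 * k + 56) * ℓ
      ≤⟨ a-string-far k ℓ (sum distances) (γℓ ℓ) blocks-far γℓ≡ ⟩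
    100 * (sum distances + γℓ ℓ)
      ≡⟨ cong (100 *_) (sym split) ⟩
    100 * Ham w (aStr i (compl (wb i)) φ (compl wc))
      ∎
    where
    open ≤-Reasoning
    distances : Fin k → ℕ
    distances j = Ham (wb j) (aBlocks i j)
    split : Ham w (aStr i (compl (wb i)) φ (compl wc)) ≡ sum distances + γℓ ℓ
    split = trans (Ham-assemble wb (aBlocks i) wc (compl wc))
                  (cong (sum distances +_) (Ham-compl-self wc))
    blocks-far : k * (5 * ℓ) + 5 * ℓ ≤ 10 * sum distances
    blocks-far = subst (k * (5 * ℓ) + 5 * ℓ ≤_) (sym (*-distribˡ-sum 10 distances))
                   (sum-≥-one (5 * ℓ) (5 * ℓ) _ i (aBlock-far i) (aBlock-sel-far i))

  compl-not-in-F : ∀ i → ¬ InF ι (compl (wb i))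
  compl-not-in-F i inF = <⇒≱ (proj₁ close i (compl (wb i)) φ (compl wc) inF) (a-far i)

  far-vertex : ∀ i → ∃ λ u → ¬ (10 * Ham (ι u) (compl (wb i)) ≤ 9 * ℓ)
  far-vertex i = ¬∀⟶∃¬ n _ (λ u → 10 * Ham (ι u) (compl (wb i)) ≤? 9 * ℓ) (compl-not-in-F i)

  f : Fin k → Fin n
  f i = proj₁ (far-vertex i)

  f-far : ∀ i → 5 * ℓ + 4 * ℓ ≤ 10 * Ham (wb i) (compl (ι (f i)))
  f-far i = far-block ℓ (Ham (wb i) (compl (ι (f i)))) far
    where
    far : 9 * ℓ < 10 * Ham (wb i) (compl (ι (f i)))
    far = subst (λ h → 9 * ℓ < 10 * h) (Ham-compl-swap (ι (f i)) (wb i))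
                (≰⇒> (proj₂ (far-vertex i)))

  bBlocks : Fin k → Fin k → Fin k → Vec Bool ℓ
  bBlocks i j = proj₁ (bStr-assembled ι i j (f i) (f j) φ)

  bBlock-fst-far : ∀ i j → 5 * ℓ + 4 * ℓ ≤ 10 * Ham (wb i) (bBlocks i j i)
  bBlock-fst-far i j = subst (λ x → 5 * ℓ + 4 * ℓ ≤ 10 * Ham (wb i) x)
                             (sym (bBlock-fst ι i j (f i) (f j) φ)) (f-far i)

  bBlock-snd-far : ∀ i j → i ≢ j → 5 * ℓ + 4 * ℓ ≤ 10 * Ham (wb j) (bBlocks i j j)
  bBlock-snd-far i j i≢j = subst (λ x → 5 * ℓ + 4 * ℓ ≤ 10 * Ham (wb j) x)
                                 (sym (bBlock-snd ι i j (f i) (f j) φ i≢j)) (f-far j)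

  bBlock-far : ∀ i j q → 5 * ℓ ≤ 10 * Ham (wb q) (bBlocks i j q)
  bBlock-far i j q = by-cases (q ≟ᶠ i) (q ≟ᶠ j)
    where
    by-cases : Dec (q ≡ i) → Dec (q ≡ j) → 5 * ℓ ≤ 10 * Ham (wb q) (bBlocks i j q)
    by-cases (yes refl) _          = ≤-trans (m≤m+n (5 * ℓ) (4 * ℓ)) (bBlock-fst-far q j)
    by-cases (no q≢i)   (yes refl) = ≤-trans (m≤m+n (5 * ℓ) (4 * ℓ))
                                             (bBlock-snd-far i q (λ i≡q → q≢i (sym i≡q)))
    by-cases (no q≢i)   (no q≢j)   = subst (λ x → 5 * ℓ ≤ 10 * Ham (wb q) x)
                                           (sym (bBlock-other ι i j (f i) (f j) φ q q≢i q≢j)) (φ-far q)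

  b-far : ∀ i j → i ≢ j → (50 * k + 56) * ℓ ≤ 100 * Ham w (bStr ι i j (f i) (f j) φ)
  b-far i j i≢j = begin
    (50 * k + 56) * ℓ
      ≤⟨ b-string-far k ℓ (sum distances) (Ham wc (const false)) blocks-far ⟩
    100 * (sum distances + Ham wc (const false))
      ≡⟨ cong (100 *_) (sym split) ⟩
    100 * Ham w (bStr ι i j (f i) (f j) φ)
      ∎
    where
    open ≤-Reasoning
    distances : Fin k → ℕ
    distances q = Ham (wb q) (bBlocks i j q)
    split : Ham w (bStr ι i j (f i) (f j) φ) ≡ sum distances + Ham wc (const false)
    split = Ham-assemble wb (bBlocks i j) wc (const false)
    blocks-far : k * (5 * ℓ) + 4 * ℓ + 4 * ℓ ≤ 10 * sum distances
    blocks-far = subst (k * (5 * ℓ) + 4 * ℓ + 4 * ℓ ≤_) (sym (*-distribˡ-sum 10 distances))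
                   (sum-≥-two (5 * ℓ) (4 * ℓ) (4 * ℓ) _ i j i≢j (bBlock-far i j)
                              (bBlock-fst-far i j) (bBlock-snd-far i j i≢j))

  good-pair : ∀ i j → i <ᶠ j → ¬ (f i ≡ f j ⊎ ¬ Adj G (f i) (f j))
  good-pair i j i<j bad = <⇒≱ (proj₂ close i j (f i) (f j) φ i<j bad) (b-far i j (<ᶠ⇒≢ i<j))

  f-injective : ∀ {i j} → f i ≡ f j → i ≡ j
  f-injective {i} {j} fi≡fj = by-cases (<ᶠ-cmp i j)
    where
    by-cases : Tri (i <ᶠ j) (i ≡ j) (j <ᶠ i) → i ≡ j
    by-cases (tri< i<j _ _) = ⊥-elim (good-pair i j i<j (inj₁ fi≡fj))
    by-cases (tri≈ _ i≡j _) = i≡j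
    by-cases (tri> _ _ j<i) = ⊥-elim (good-pair j i j<i (inj₁ (sym fi≡fj)))

  f-adjacent : ∀ i j → i ≢ j → Adj G (f i) (f j)
  f-adjacent i j i≢j = by-cases (adj? G (f i) (f j)) (<ᶠ-cmp i j)
    where
    by-cases : Dec (Adj G (f i) (f j)) → Tri (i <ᶠ j) (i ≡ j) (j <ᶠ i) → Adj G (f i) (f j)
    by-cases (yes adj) _              = adj
    by-cases (no ¬adj) (tri< i<j _ _) = ⊥-elim (good-pair i j i<j (inj₂ ¬adj))
    by-cases (no ¬adj) (tri≈ _ i≡j _) = ⊥-elim (i≢j i≡j)
    by-cases (no ¬adj) (tri> _ _ j<i) =
      ⊥-elim (good-pair j i j<i (inj₂ (λ adj → ¬adj (SimpleGraph.sym G adj))))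

  clique : HasClique G k
  clique = f , f-injective , f-adjacent

lemma4 : ∀ {n} (G : SimpleGraph n) (k ℓ : ℕ) (ι : Fin n → Vec Bool ℓ) →
         0 < k → 0 < ℓ → 100 ∣ ℓ → GoodCode ℓ ι →
         (w : Vec Bool (Len k ℓ)) → AllClose k G ι w →
         HasClique G k
lemma4 G k ℓ ι _ _ 100∣ℓ _ w close =
  let wb , wc , w≡ = assemble-onto w in
  CliqueFromCentre.clique G k ℓ ι (γℓ-exact 100∣ℓ) wb wc (subst (AllClose k G ι) w≡ close)
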